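{- Let $G$ be a connected finite simple graph on $n\ge3$ vertices. Then the $1$-shunt intersection graph $A_1(G)$ has exactly $n$ vertices if and only if $G$ is a bistar $S_{m_1,m_2}$ (for some $m_1,m_2\ge1$).
   Context: The bistar $S_{m_1,m_2}$ is obtained from the stars $K_{1,m_1}$ and $K_{1,m_2}$ by joining their centres with an edge. A $1$-arc of $G$ is an ordered pair $(u,v)$ with $uv\in E(G)$, written $uv$; it can be shunted onto the $1$-arc $vw$ if $w\neq u$ and $vw\in E(G)$. $A_1(G)$ has as vertices the $1$-arcs that can be shunted onto some other $1$-arc; two distinct vertices are adjacent iff the corresponding $1$-arcs share a vertex of $G$. -}

module Defs where

open import Data.Nat using (ℕ; _+_; _≡ᵇ_; _<ᵇ_)
open import Data.Fin using (Fin; toℕ; _≟_)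
open import Data.Bool using (Bool; true; false; _∧_; _∨_; not; T)
open import Data.List using (allFin)
open import Data.Bool.ListAction using (any)
open import Data.Empty using (⊥)
open import Data.Product using (Σ; _×_; _,_; proj₁; proj₂)
open import Relation.Nullary.Decidable using (⌊_⌋)
open import Relation.Binary.PropositionalEquality using (_≡_)
open import Function.Bundles using (_↔_; Inverse)

record Graph (n : ℕ) : Set where
  field
    adj    : Fin n → Fin n → Bool
    sym    : ∀ u v → adj u v ≡ adj v u
    irrefl : ∀ u → adj u u ≡ false
open Graph public

data Walk {n : ℕ} (G : Graph n) : Fin n → Fin n → Set where
  nil  : ∀ {u} → Walk G u u
  cons : ∀ {u v w} → T (adj G u v) → Walk G v w → Walk G u w

Connected : {n : ℕ} → Graph n → Set
Connected {n} G = ∀ (u v : Fin n) → Walk G u v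

-- The 1-arc uv (uv ∈ E(G)) can be shunted onto some other 1-arc vw (w ≠ u, vw ∈ E(G)).
isA1Vertex : {n : ℕ} → Graph n → Fin n → Fin n → Bool
isA1Vertex {n} G u v =
  adj G u v ∧ any (λ w → adj G v w ∧ not ⌊ w ≟ u ⌋) (allFin n)

A1Vertex : {n : ℕ} → Graph n → Set
A1Vertex {n} G = Σ (Fin n × Fin n) (λ p → T (isA1Vertex G (proj₁ p) (proj₂ p)))

A1Adj : {n : ℕ} → (G : Graph n) → A1Vertex G → A1Vertex G → Set
A1Adj G ((a , b) , _) ((c , d) , _) =
  ((a , b) ≡ (c , d) → ⊥) ×
  T (⌊ a ≟ c ⌋ ∨ ⌊ a ≟ d ⌋ ∨ ⌊ b ≟ c ⌋ ∨ ⌊ b ≟ d ⌋)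

-- Bistar S_{m₁,m₂} on vertex set Fin (2 + m₁ + m₂):
-- vertex 0 = centre of K_{1,m₁}, vertex 1 = centre of K_{1,m₂},
-- vertices 2 .. m₁+1 are the leaves of the first star,
-- vertices m₁+2 .. m₁+m₂+1 are the leaves of the second star.
module _ (m₁ m₂ : ℕ) where
  private
    c₁ c₂ l₁ l₂ : Fin (2 + m₁ + m₂) → Bool
    c₁ i = toℕ i ≡ᵇ 0
    c₂ i = toℕ i ≡ᵇ 1
    l₁ i = not (c₁ i) ∧ not (c₂ i) ∧ (toℕ i <ᵇ 2 + m₁)
    l₂ i = not (toℕ i <ᵇ 2 + m₁)

  bistarAdj : Fin (2 + m₁ + m₂) → Fin (2 + m₁ + m₂) → Bool
  bistarAdj i j =
    (c₁ i ∧ c₂ j) ∨ (c₂ i ∧ c₁ j) ∨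
    (c₁ i ∧ l₁ j) ∨ (l₁ i ∧ c₁ j) ∨
    (c₂ i ∧ l₂ j) ∨ (l₂ i ∧ c₂ j)

IsoToAdj : {n m : ℕ} → Graph n → (Fin m → Fin m → Bool) → Set
IsoToAdj {n} {m} G A =
  Σ (Fin n ↔ Fin m) (λ f → ∀ u v → adj G u v ≡ A (Inverse.to f u) (Inverse.to f v))

IsBistar : {n : ℕ} → Graph n → ℕ → ℕ → Set
IsBistar G m₁ m₂ = IsoToAdj G (bistarAdj m₁ m₂)

-- A bijection between the vertices and the shuntable 1-arcs forces every vertex to be
-- the tail of exactly one shuntable 1-arc. If some u were the tail of none, every
-- neighbour of u would be a leaf, so G would be a star centred at u whose shuntable arcs
-- all end at u; they are then determined by their tails, which avoid u, so there are
-- fewer than n. Otherwise choosing one shuntable arc per vertex is an injection of the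
-- vertices into the shuntable arcs, hence onto, leaving no room for a second one.
-- Write σ u for its head. An edge ux with x ≠ σ u makes x a leaf hanging off u. For any z
-- the hubs h = σ z and h′ = σ h satisfy σ h′ = h, every other vertex hangs off h or h′,
-- and both have such leaves: G is S_{m₁,m₂}. Conversely, in S_{m₁,m₂} with m₁, m₂ ≥ 1
-- a 1-arc can be shunted iff it ends in a hub, and every vertex has exactly one hub
-- neighbour.

module Submission where

open import Defs hiding (sym)
open import Data.Nat using (ℕ; zero; suc; _+_; _≤_; _<ᵇ_; s≤s; z≤n; >-nonZero⁻¹)
open import Data.Nat.Properties using (n≮n)
open import Data.Fin using (Fin; zero; suc; toℕ; _≟_; punchOut; splitAt; join; _↑ˡ_; _↑ʳ_)
open import Data.Fin.Properties
  using (nonZeroIndex; any?; injective⇒≤; punchOut-injective; splitAt-↑ˡ; splitAt-↑ʳ; join-splitAt)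
open import Data.Sum.Properties using ([,]-map)
open import Data.Bool using (Bool; true; false; T)
open import Data.Bool.Properties using (T-≡; T-∧; T-irrelevant)
open import Data.List using (allFin)
open import Data.List.Relation.Unary.Any using (satisfied)
open import Data.List.Relation.Unary.Any.Properties using (any⁺; any⁻)
open import Data.List.Membership.Propositional using (lose)
open import Data.List.Membership.Propositional.Properties using (∈-allFin)
open import Data.Unit using (⊤; tt)
open import Data.Empty using (⊥-elim)
open import Data.Sum using (_⊎_; inj₁; inj₂; [_,_]′)
open import Data.Product using (Σ; ∃; _×_; _,_; proj₁; proj₂)
open import Data.Product.Function.Dependent.Propositional using (Σ-↔)
open import Function.Base using (_∘_; const; flip)
open import Function.Bundles using (_↔_; _⇔_; Inverse; Injection; Equivalence; mk↔ₛ′; mk⇔)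
open import Function.Definitions using (Injective)
open import Function.Properties.Inverse using (↔-refl; ↔-sym; ↔-trans; ↔⇒↣)
open import Relation.Nullary using (¬_; yes; no; contradiction)
open import Relation.Nullary.Decidable
  using (⌊_⌋; T?; _⊎-dec_; toWitness; fromWitness; toWitnessFalse; fromWitnessFalse)
open import Relation.Nullary.Irrelevant using (Irrelevant)
open import Relation.Unary using (Decidable)
open import Relation.Binary.Definitions using (DecidableEquality)
open import Relation.Binary.PropositionalEquality
open import Axiom.UniquenessOfIdentityProofs.WithK using (uip)

injective⇒surjective : ∀ {m} {f : Fin m → Fin m} → Injective _≡_ _≡_ f →
                       ∀ y → ∃ λ x → f x ≡ y
injective⇒surjective {suc m} {f} f-inj y with any? (λ x → f x ≟ y)
... | yes hit = hit
... | no miss = contradiction (injective⇒≤ punchOut∘f-injective) (n≮n m)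
  where
  y≢f : ∀ x → y ≢ f x
  y≢f x eq = miss (x , sym eq)

  punchOut∘f-injective : Injective _≡_ _≡_ (λ x → punchOut (y≢f x))
  punchOut∘f-injective eq = f-inj (punchOut-injective (y≢f _) (y≢f _) eq)

count : ∀ {n} {P : Fin n → Set} → Decidable P → ℕ
count {zero}  P? = 0
count {suc n} P? with P? zero
... | yes _ = suc (count (P? ∘ suc))
... | no  _ = count (P? ∘ suc)

Σ↔count : ∀ {n} {P : Fin n → Set} (P? : Decidable P) → (∀ {x} → Irrelevant (P x)) →
          Σ (Fin n) P ↔ Fin (count P?)
Σ↔count {zero}  P? irr = mk↔ₛ′ (λ ()) (λ ()) (λ ()) (λ ())
Σ↔count {suc n} {P} P? irr with P? zero | Σ↔count (P? ∘ suc) irr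
... | yes p₀ | rest = mk↔ₛ′ to from to∘from from∘to
  where
  open Inverse rest using (strictlyInverseˡ; strictlyInverseʳ)
                    renaming (to to toRest; from to fromRest)
  to : Σ (Fin (suc n)) P → Fin (suc (count (P? ∘ suc)))
  to (zero  , _) = zero
  to (suc x , p) = suc (toRest (x , p))
  from : Fin (suc (count (P? ∘ suc))) → Σ (Fin (suc n)) P
  from zero    = zero , p₀
  from (suc i) = let (x , p) = fromRest i in suc x , p
  to∘from : ∀ i → to (from i) ≡ i
  to∘from zero    = refl
  to∘from (suc i) = cong suc (strictlyInverseˡ i)
  from∘to : ∀ xp → from (to xp) ≡ xp
  from∘to (zero  , p) = cong (zero ,_) (irr p₀ p)
  from∘to (suc x , p) = cong (λ (y , q) → suc y , q) (strictlyInverseʳ (x , p))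
... | no ¬p₀ | rest = mk↔ₛ′ to from strictlyInverseˡ from∘to
  where
  open Inverse rest using (strictlyInverseˡ; strictlyInverseʳ)
                    renaming (to to toRest; from to fromRest)
  to : Σ (Fin (suc n)) P → Fin (count (P? ∘ suc))
  to (zero  , p) = contradiction p ¬p₀
  to (suc x , p) = toRest (x , p)
  from : Fin (count (P? ∘ suc)) → Σ (Fin (suc n)) P
  from i = let (x , p) = fromRest i in suc x , p
  from∘to : ∀ xp → from (to xp) ≡ xp
  from∘to (zero  , p) = contradiction p ¬p₀
  from∘to (suc x , p) = cong (λ (y , q) → suc y , q) (strictlyInverseʳ (x , p))

T⇒≡true : ∀ {b} → T b → b ≡ true
T⇒≡true = Equivalence.to T-≡

¬T⇒≡false : ∀ {b} → ¬ T b → b ≡ false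
¬T⇒≡false {false} _  = refl
¬T⇒≡false {true}  ¬t = contradiction tt ¬t

Fibre : {A K : Set} → (A → K) → K → Set
Fibre {A} k c = Σ A λ x → k x ≡ c

fibre-≡ : {A K : Set} {k : A → K} {c : K} {x y : A} {p : k x ≡ c} {q : k y ≡ c} →
          x ≡ y → _≡_ {A = Fibre k c} (x , p) (y , q)
fibre-≡ refl = cong (_ ,_) (uip _ _)

fibre-proj₁↔ : {K : Set} {S : K → Set} {c : K} → Fibre (proj₁ {B = S}) c ↔ S c
fibre-proj₁↔ = mk↔ₛ′ (λ { ((_ , s) , refl) → s }) (λ s → (_ , s) , refl)
                      (λ _ → refl) (λ { ((_ , s) , refl) → refl })

module _ {A K : Set} where

  partition↔ : (k : A → K) → A ↔ Σ K (Fibre k)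
  partition↔ k = mk↔ₛ′ (λ x → k x , x , refl) (λ (_ , x , _) → x)
                        (λ { (_ , x , refl) → refl }) (λ _ → refl)

  fibre-∘↔ : {B : Set} (e : A ↔ B) (k : B → K) {c : K} → Fibre (k ∘ Inverse.to e) c ↔ Fibre k c
  fibre-∘↔ e k = mk↔ₛ′ (λ (x , p) → to x , p)
                        (λ (y , q) → from y , trans (cong k (strictlyInverseˡ y)) q)
                        (λ (y , q) → fibre-≡ (strictlyInverseˡ y))
                        (λ (x , p) → fibre-≡ (strictlyInverseʳ x))
    where open Inverse e

  fibre↔⊤ : (k : A → K) {c : K} (a : A) → k a ≡ c → (∀ {x} → k x ≡ c → x ≡ a) → Fibre k c ↔ ⊤
  fibre↔⊤ k a ka≡c unique = mk↔ₛ′ _ (λ _ → a , ka≡c) (λ _ → refl)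
                                  (λ (x , p) → fibre-≡ (sym (unique p)))

  fibre↔⊤⇒unique : {k : A → K} {c : K} → Fibre k c ↔ ⊤ → ∀ {x y} → k x ≡ c → k y ≡ c → x ≡ y
  fibre↔⊤⇒unique e p q = trans (sym (cong proj₁ (strictlyInverseʳ (_ , p))))
                                (cong proj₁ (strictlyInverseʳ (_ , q)))
    where open Inverse e

data Role : Set where
  hub₁ hub₂ leaf₁ leaf₂ : Role

_≟ᴿ_ : DecidableEquality Role
hub₁  ≟ᴿ hub₁  = yes refl
hub₁  ≟ᴿ hub₂  = no λ ()
hub₁  ≟ᴿ leaf₁ = no λ ()
hub₁  ≟ᴿ leaf₂ = no λ ()
hub₂  ≟ᴿ hub₁  = no λ ()
hub₂  ≟ᴿ hub₂  = yes refl
hub₂  ≟ᴿ leaf₁ = no λ ()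
hub₂  ≟ᴿ leaf₂ = no λ ()
leaf₁ ≟ᴿ hub₁  = no λ ()
leaf₁ ≟ᴿ hub₂  = no λ ()
leaf₁ ≟ᴿ leaf₁ = yes refl
leaf₁ ≟ᴿ leaf₂ = no λ ()
leaf₂ ≟ᴿ hub₁  = no λ ()
leaf₂ ≟ᴿ hub₂  = no λ ()
leaf₂ ≟ᴿ leaf₁ = no λ ()
leaf₂ ≟ᴿ leaf₂ = yes refl

-- Adjacency in S_{m₁,m₂} depends only on roles, along the path leaf₁ — hub₁ — hub₂ — leaf₂.
-- The partner of r is its neighbour towards the central edge: the head of every
-- shuntable 1-arc out of a vertex of role r.
partner : Role → Role
partner hub₁  = hub₂
partner hub₂  = hub₁
partner leaf₁ = hub₁
partner leaf₂ = hub₂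

roleAdj : Role → Role → Bool
roleAdj r s = ⌊ s ≟ᴿ partner r ⊎-dec r ≟ᴿ partner s ⌋

roleAdj⇔ : ∀ {r s} → T (roleAdj r s) ⇔ (s ≡ partner r ⊎ r ≡ partner s)
roleAdj⇔ = mk⇔ toWitness fromWitness

partner-adj : ∀ r → T (roleAdj r (partner r))
partner-adj r = Equivalence.from (roleAdj⇔ {r}) (inj₁ refl)

partner³ : ∀ r → partner (partner (partner r)) ≡ partner r
partner³ hub₁  = refl
partner³ hub₂  = refl
partner³ leaf₁ = refl
partner³ leaf₂ = refl

path-through-partner : ∀ {r s t} → T (roleAdj r s) → T (roleAdj s t) →
                       s ≡ partner r ⊎ (r ≡ partner s × t ≡ partner s)
path-through-partner rs st with Equivalence.to roleAdj⇔ rs | Equivalence.to roleAdj⇔ st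
... | inj₁ s≡pr | _         = inj₁ s≡pr
... | inj₂ r≡ps | inj₁ t≡ps = inj₂ (r≡ps , t≡ps)
... | inj₂ refl | inj₂ refl = inj₁ (sym (partner³ _))

detour : ∀ r → ∃ λ s → T (roleAdj (partner r) s) × s ≢ r
detour hub₁  = leaf₂ , _ , λ ()
detour hub₂  = leaf₁ , _ , λ ()
detour leaf₁ = hub₂  , _ , λ ()
detour leaf₂ = hub₁  , _ , λ ()

Slot : ℕ → ℕ → Role → Set
Slot _  _  hub₁  = ⊤
Slot _  _  hub₂  = ⊤
Slot m₁ _  leaf₁ = Fin m₁
Slot _  m₂ leaf₂ = Fin m₂

occupied : ∀ {m₁ m₂} → 1 ≤ m₁ → 1 ≤ m₂ → ∀ r → Slot m₁ m₂ r
occupied _         _         hub₁  = tt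
occupied _         _         hub₂  = tt
occupied (s≤s z≤n) _         leaf₁ = zero
occupied _         (s≤s z≤n) leaf₂ = zero

leafRole : Bool → Role
leafRole true  = leaf₁
leafRole false = leaf₂

splitAt-<ᵇ : ∀ m {n} (i : Fin (m + n)) → [ const true , const false ]′ (splitAt m i) ≡ (toℕ i <ᵇ m)
splitAt-<ᵇ zero    i       = refl
splitAt-<ᵇ (suc m) zero    = refl
splitAt-<ᵇ (suc m) (suc i) = trans ([,]-map (splitAt m i)) (splitAt-<ᵇ m i)

module _ (m₁ m₂ : ℕ) where

  leafSlot : Fin m₁ ⊎ Fin m₂ → Σ Role (Slot m₁ m₂)
  leafSlot (inj₁ i) = leaf₁ , i
  leafSlot (inj₂ j) = leaf₂ , j

  toSlot : Fin (2 + m₁ + m₂) → Σ Role (Slot m₁ m₂)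
  toSlot zero          = hub₁ , tt
  toSlot (suc zero)    = hub₂ , tt
  toSlot (suc (suc i)) = leafSlot (splitAt m₁ i)

  fromSlot : Σ Role (Slot m₁ m₂) → Fin (2 + m₁ + m₂)
  fromSlot (hub₁  , _) = zero
  fromSlot (hub₂  , _) = suc zero
  fromSlot (leaf₁ , i) = suc (suc (i ↑ˡ m₂))
  fromSlot (leaf₂ , j) = suc (suc (m₁ ↑ʳ j))

  bistarSlot↔ : Fin (2 + m₁ + m₂) ↔ Σ Role (Slot m₁ m₂)
  bistarSlot↔ = mk↔ₛ′ toSlot fromSlot to∘from from∘to
    where
    to∘from : ∀ s → toSlot (fromSlot s) ≡ s
    to∘from (hub₁  , _) = refl
    to∘from (hub₂  , _) = refl
    to∘from (leaf₁ , i) = cong leafSlot (splitAt-↑ˡ m₁ i m₂)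
    to∘from (leaf₂ , j) = cong leafSlot (splitAt-↑ʳ m₁ m₂ j)

    fromSlot∘leafSlot : ∀ s → fromSlot (leafSlot s) ≡ suc (suc (join m₁ m₂ s))
    fromSlot∘leafSlot (inj₁ _) = refl
    fromSlot∘leafSlot (inj₂ _) = refl

    from∘to : ∀ i → fromSlot (toSlot i) ≡ i
    from∘to zero          = refl
    from∘to (suc zero)    = refl
    from∘to (suc (suc i)) = trans (fromSlot∘leafSlot (splitAt m₁ i))
                                  (cong (λ j → suc (suc j)) (join-splitAt m₁ m₂ i))

  bistarRole : Fin (2 + m₁ + m₂) → Role
  bistarRole i = proj₁ (toSlot i)

  bistarRole-leaf : ∀ i → bistarRole (suc (suc i)) ≡ leafRole (toℕ i <ᵇ m₁)
  bistarRole-leaf i = trans (leafSlot-role (splitAt m₁ i)) (cong leafRole (splitAt-<ᵇ m₁ i))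
    where
    leafSlot-role : ∀ s → proj₁ (leafSlot s) ≡ leafRole ([ const true , const false ]′ s)
    leafSlot-role (inj₁ _) = refl
    leafSlot-role (inj₂ _) = refl

  bistarAdj-role : ∀ i j → bistarAdj m₁ m₂ i j ≡ roleAdj (bistarRole i) (bistarRole j)
  bistarAdj-role zero          zero          = refl
  bistarAdj-role zero          (suc zero)    = refl
  bistarAdj-role (suc zero)    zero          = refl
  bistarAdj-role (suc zero)    (suc zero)    = refl
  bistarAdj-role zero          (suc (suc j)) rewrite bistarRole-leaf j with toℕ j <ᵇ m₁
  ... | true  = refl
  ... | false = refl
  bistarAdj-role (suc zero)    (suc (suc j)) rewrite bistarRole-leaf j with toℕ j <ᵇ m₁
  ... | true  = refl
  ... | false = refl
  bistarAdj-role (suc (suc i)) zero          rewrite bistarRole-leaf i with toℕ i <ᵇ m₁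
  ... | true  = refl
  ... | false = refl
  bistarAdj-role (suc (suc i)) (suc zero)    rewrite bistarRole-leaf i with toℕ i <ᵇ m₁
  ... | true  = refl
  ... | false = refl
  bistarAdj-role (suc (suc i)) (suc (suc j))
    rewrite bistarRole-leaf i | bistarRole-leaf j with toℕ i <ᵇ m₁ | toℕ j <ᵇ m₁
  ... | true  | true  = refl
  ... | true  | false = refl
  ... | false | true  = refl
  ... | false | false = refl

  bistarRole-fibre↔ : ∀ r → Fibre bistarRole r ↔ Slot m₁ m₂ r
  bistarRole-fibre↔ r = ↔-trans (fibre-∘↔ bistarSlot↔ (proj₁ {B = Slot m₁ m₂})) fibre-proj₁↔

record BistarStructure {n : ℕ} (G : Graph n) (m₁ m₂ : ℕ) : Set where
  field
    role       : Fin n → Role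
    adj-role   : ∀ u v → adj G u v ≡ roleAdj (role u) (role v)
    fibre↔slot : ∀ r → Fibre role r ↔ Slot m₁ m₂ r

module _ {n : ℕ} {G : Graph n} {m₁ m₂ : ℕ} where

  isBistar⇒structure : IsBistar G m₁ m₂ → BistarStructure G m₁ m₂
  isBistar⇒structure (f , adj≡) = record
    { role       = bistarRole m₁ m₂ ∘ Inverse.to f
    ; adj-role   = λ u v → trans (adj≡ u v) (bistarAdj-role m₁ m₂ (Inverse.to f u) (Inverse.to f v))
    ; fibre↔slot = λ r → ↔-trans (fibre-∘↔ f (bistarRole m₁ m₂)) (bistarRole-fibre↔ m₁ m₂ r)
    }

  structure⇒isBistar : BistarStructure G m₁ m₂ → IsBistar G m₁ m₂
  structure⇒isBistar S = f , adj≡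
    where
    open BistarStructure S
    open Inverse
    f : Fin n ↔ Fin (2 + m₁ + m₂)
    f = ↔-trans (partition↔ role)
          (↔-trans (Σ-↔ ↔-refl (fibre↔slot _)) (↔-sym (bistarSlot↔ m₁ m₂)))

    role-to : ∀ u → bistarRole m₁ m₂ (to f u) ≡ role u
    role-to u = cong proj₁ (strictlyInverseˡ (bistarSlot↔ m₁ m₂) _)

    adj≡ : ∀ u v → adj G u v ≡ bistarAdj m₁ m₂ (to f u) (to f v)
    adj≡ u v = begin
      adj G u v                                                  ≡⟨ adj-role u v ⟩
      roleAdj (role u) (role v)                                  ≡⟨ cong₂ roleAdj (role-to u) (role-to v) ⟨
      roleAdj (bistarRole m₁ m₂ (to f u)) (bistarRole m₁ m₂ (to f v)) ≡⟨ bistarAdj-role m₁ m₂ (to f u) (to f v) ⟨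
      bistarAdj m₁ m₂ (to f u) (to f v)                          ∎
      where open ≡-Reasoning

module Shunting {n : ℕ} (G : Graph n) where

  Adj : Fin n → Fin n → Set
  Adj u v = T (adj G u v)

  Shunts : Fin n → Fin n → Set
  Shunts u v = T (isA1Vertex G u v)

  adj-sym : ∀ {u v} → Adj u v → Adj v u
  adj-sym {u} {v} = subst T (Graph.sym G u v)

  adj-irrefl : ∀ {u} → ¬ Adj u u
  adj-irrefl {u} = subst T (irrefl G u)

  adj⇒≢ : ∀ {u v} → Adj u v → u ≢ v
  adj⇒≢ uv refl = adj-irrefl uv

  shunt-intro : ∀ {u v w} → Adj u v → Adj v w → w ≢ u → Shunts u v
  shunt-intro {u} {v} {w} uv vw w≢u =
    Equivalence.from T-∧ (uv , any⁺ _ (lose (∈-allFin w) (Equivalence.from T-∧ (vw , fromWitnessFalse w≢u))))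

  shunt-adj : ∀ {u v} → Shunts u v → Adj u v
  shunt-adj p = proj₁ (Equivalence.to T-∧ p)

  shunt-onward : ∀ {u v} → Shunts u v → ∃ λ w → Adj v w × w ≢ u
  shunt-onward {u} {v} p
    with w , q ← satisfied (any⁻ _ (allFin n) (proj₂ (Equivalence.to T-∧ p)))
    with vw , w≢u ← Equivalence.to T-∧ q
    = w , vw , toWitnessFalse w≢u

  pendant : ∀ {u v w} → Adj u v → ¬ Shunts u v → Adj v w → w ≡ u
  pendant {u} {w = w} uv ¬p vw with w ≟ u
  ... | yes w≡u = w≡u
  ... | no  w≢u = contradiction (shunt-intro uv vw w≢u) ¬p

  walk-closed : (P : Fin n → Set) → (∀ {x y} → P x → Adj x y → P y) →
                ∀ {u v} → P u → Walk G u v → P v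
  walk-closed P step pu nil          = pu
  walk-closed P step pu (cons uv vw) = walk-closed P step (step pu uv) vw

  arc-≡ : ∀ {u v v′} {p : Shunts u v} {q : Shunts u v′} →
          v ≡ v′ → _≡_ {A = A1Vertex G} ((u , v) , p) ((u , v′) , q)
  arc-≡ {p = p} {q} refl = cong (_ ,_) (T-irrelevant p q)

  tail : A1Vertex G → Fin n
  tail ((u , _) , _) = u

  record ShuntMap : Set where
    field
      target        : Fin n → Fin n
      shunts-target : ∀ u → Shunts u (target u)
      target-unique : ∀ {u v} → Shunts u v → v ≡ target u

  shuntMap⇒↔ : ShuntMap → Fin n ↔ A1Vertex G
  shuntMap⇒↔ σ = mk↔ₛ′ (λ u → (u , target u) , shunts-target u) tail
                        (λ (_ , p) → arc-≡ (sym (target-unique p))) (λ _ → refl)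
    where open ShuntMap σ

  module _ (connected : Connected G) {u : Fin n} (¬shunt : ¬ ∃ (Shunts u)) where

    unshuntable⇒dominating : ∀ x → x ≡ u ⊎ Adj u x
    unshuntable⇒dominating x = walk-closed (λ x → x ≡ u ⊎ Adj u x) step (inj₁ refl) (connected u x)
      where
      step : ∀ {x y} → x ≡ u ⊎ Adj u x → Adj x y → y ≡ u ⊎ Adj u y
      step (inj₁ refl) xy = inj₂ xy
      step (inj₂ ux)   xy = inj₁ (pendant ux (¬shunt ∘ (_ ,_)) xy)

    unshuntable⇒star : ∀ {a b} → Shunts a b → b ≡ u
    unshuntable⇒star {a} {b} p with b ≟ u | unshuntable⇒dominating b
    ... | yes b≡u | _        = b≡u
    ... | no  b≢u | inj₁ b≡u = contradiction b≡u b≢u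
    ... | no  _   | inj₂ ub  =
      let (w , bw , w≢a) = shunt-onward p
          only-u : ∀ {y} → Adj b y → y ≡ u
          only-u = pendant ub (¬shunt ∘ (_ ,_))
      in contradiction (trans (only-u bw) (sym (only-u (adj-sym (shunt-adj p))))) w≢a

  module _ (connected : Connected G) (e : Fin n ↔ A1Vertex G) where
    open Inverse e

    everyone-shunts : ∀ u → ∃ (Shunts u)
    everyone-shunts u with any? (λ v → T? (isA1Vertex G u v))
    ... | yes shunt = shunt
    ... | no ¬shunt =
      let (x , tail≡u) = injective⇒surjective tail∘to-injective u
          (_ , p)      = to x
      in ⊥-elim (adj⇒≢ (shunt-adj p) (trans tail≡u (sym (unshuntable⇒star connected ¬shunt p))))
      where
      tail-injective : Injective _≡_ _≡_ tail
      tail-injective {(_ , b) , p} {(_ , b′) , q} refl =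
        arc-≡ (trans (unshuntable⇒star connected ¬shunt p) (sym (unshuntable⇒star connected ¬shunt q)))

      tail∘to-injective : Injective _≡_ _≡_ (tail ∘ to)
      tail∘to-injective = Injection.injective (↔⇒↣ e) ∘ tail-injective

    ↔⇒shuntMap : ShuntMap
    ↔⇒shuntMap = record
      { target        = proj₁ ∘ everyone-shunts
      ; shunts-target = proj₂ ∘ everyone-shunts
      ; target-unique = target-unique
      }
      where
      chosen : Fin n → A1Vertex G
      chosen u = (u , proj₁ (everyone-shunts u)) , proj₂ (everyone-shunts u)

      from∘chosen-injective : Injective _≡_ _≡_ (from ∘ chosen)
      from∘chosen-injective = cong tail ∘ Injection.injective (↔⇒↣ (↔-sym e))

      target-unique : ∀ {u v} → Shunts u v → v ≡ proj₁ (everyone-shunts u)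
      target-unique p
        with x , hit ← injective⇒surjective from∘chosen-injective (from (_ , p))
        with refl ← Injection.injective (↔⇒↣ (↔-sym e)) hit
        = refl

  module _ {m₁ m₂ : ℕ} (S : BistarStructure G m₁ m₂) (some-slot : ∀ r → Slot m₁ m₂ r) where
    open BistarStructure S

    adj⇒roleAdj : ∀ {u v} → Adj u v → T (roleAdj (role u) (role v))
    adj⇒roleAdj {u} {v} = subst T (adj-role u v)

    roleAdj⇒adj : ∀ {u v r s} → role u ≡ r → role v ≡ s → T (roleAdj r s) → Adj u v
    roleAdj⇒adj {u} {v} refl refl = subst T (sym (adj-role u v))

    vertexOf : ∀ r → Fibre role r
    vertexOf r = Inverse.from (fibre↔slot r) (some-slot r)

    partner-unique : ∀ {r x y} → role x ≡ partner r → role y ≡ partner r → x ≡ y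
    partner-unique {r} = fibre↔⊤⇒unique (partner-fibre↔⊤ r)
      where
      partner-fibre↔⊤ : ∀ r → Fibre role (partner r) ↔ ⊤
      partner-fibre↔⊤ hub₁  = fibre↔slot hub₂
      partner-fibre↔⊤ hub₂  = fibre↔slot hub₁
      partner-fibre↔⊤ leaf₁ = fibre↔slot hub₁
      partner-fibre↔⊤ leaf₂ = fibre↔slot hub₂

    structure⇒shuntMap : ShuntMap
    structure⇒shuntMap = record
      { target        = proj₁ ∘ vertexOf ∘ partner ∘ role
      ; shunts-target = shunts-target
      ; target-unique = target-unique
      }
      where
      shunts-target : ∀ u → Shunts u (proj₁ (vertexOf (partner (role u))))
      shunts-target u =
        let (v , v-role) = vertexOf (partner (role u))
            (t , t-adj , t≢ru) = detour (role u)
            (w , w-role) = vertexOf t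
        in shunt-intro (roleAdj⇒adj refl v-role (partner-adj (role u)))
                       (roleAdj⇒adj v-role w-role t-adj)
                       (λ w≡u → t≢ru (trans (sym w-role) (cong role w≡u)))

      target-unique : ∀ {u v} → Shunts u v → v ≡ proj₁ (vertexOf (partner (role u)))
      target-unique p with w , vw , w≢u ← shunt-onward p
        with path-through-partner (adj⇒roleAdj (shunt-adj p)) (adj⇒roleAdj vw)
      ... | inj₁ v-role           = partner-unique v-role (proj₂ (vertexOf _))
      ... | inj₂ (u-role , w-role) = contradiction (partner-unique w-role u-role) w≢u

  module _ (connected : Connected G) (σ : ShuntMap) (z : Fin n) where
    open ShuntMap σ

    target-adj : ∀ u → Adj u (target u)
    target-adj u = shunt-adj (shunts-target u)

    hangs-off : ∀ {u x y} → Adj u x → x ≢ target u → Adj x y → y ≡ u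
    hangs-off ux x≢σu = pendant ux (x≢σu ∘ target-unique)

    h h′ : Fin n
    h  = target z
    h′ = target h

    h≢h′ : h ≢ h′
    h≢h′ = adj⇒≢ (target-adj h)

    leaf-of-h : ∃ λ l → Adj h l × l ≢ h′
    leaf-of-h with z ≟ h′ | shunt-onward (shunts-target z)
    ... | no  z≢h′ | _              = z , adj-sym (target-adj z) , z≢h′
    ... | yes z≡h′ | w , hw , w≢z  = w , hw , w≢z ∘ flip trans (sym z≡h′)

    target-h′ : target h′ ≡ h
    target-h′ = let (_ , hl , l≢h′) = leaf-of-h
                in sym (target-unique (shunt-intro (adj-sym (target-adj h)) hl l≢h′))

    hangs-off-h′ : ∀ {x y} → Adj h′ x → x ≢ h → Adj x y → y ≡ h′
    hangs-off-h′ h′x x≢h = hangs-off h′x (x≢h ∘ flip trans target-h′)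

    near-hubs : ∀ x → x ≡ h ⊎ x ≡ h′ ⊎ Adj h x ⊎ Adj h′ x
    near-hubs x = walk-closed _ step (inj₁ refl) (connected h x)
      where
      step : ∀ {x y} → x ≡ h ⊎ x ≡ h′ ⊎ Adj h x ⊎ Adj h′ x → Adj x y →
             y ≡ h ⊎ y ≡ h′ ⊎ Adj h y ⊎ Adj h′ y
      step (inj₁ refl)               xy = inj₂ (inj₂ (inj₁ xy))
      step (inj₂ (inj₁ refl))        xy = inj₂ (inj₂ (inj₂ xy))
      step {x} (inj₂ (inj₂ (inj₁ hx))) xy with x ≟ h′
      ... | yes refl = inj₂ (inj₂ (inj₂ xy))
      ... | no  x≢h′ = inj₁ (hangs-off hx x≢h′ xy)
      step {x} (inj₂ (inj₂ (inj₂ h′x))) xy with x ≟ h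
      ... | yes refl = inj₂ (inj₂ (inj₁ xy))
      ... | no  x≢h  = inj₂ (inj₁ (hangs-off-h′ h′x x≢h xy))

    data Placement (x : Fin n) : Role → Set where
      at-hub₁  : x ≡ h → Placement x hub₁
      at-hub₂  : x ≡ h′ → Placement x hub₂
      at-leaf₁ : Adj h x → x ≢ h′ → Placement x leaf₁
      at-leaf₂ : Adj h′ x → x ≢ h → ¬ Adj h x → Placement x leaf₂

    placement : ∀ x → ∃ (Placement x)
    placement x with x ≟ h | x ≟ h′ | T? (adj G h x) | near-hubs x
    ... | yes x≡h | _        | _       | _ = hub₁ , at-hub₁ x≡h
    ... | no  _   | yes x≡h′ | _       | _ = hub₂ , at-hub₂ x≡h′
    ... | no  _   | no  x≢h′ | yes hx  | _ = leaf₁ , at-leaf₁ hx x≢h′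
    ... | no  x≢h | no  x≢h′ | no  ¬hx | near = leaf₂ , at-leaf₂ (adj-h′ near) x≢h ¬hx
      where
      adj-h′ : x ≡ h ⊎ x ≡ h′ ⊎ Adj h x ⊎ Adj h′ x → Adj h′ x
      adj-h′ (inj₁ x≡h)                = contradiction x≡h x≢h
      adj-h′ (inj₂ (inj₁ x≡h′))        = contradiction x≡h′ x≢h′
      adj-h′ (inj₂ (inj₂ (inj₁ hx)))   = contradiction hx ¬hx
      adj-h′ (inj₂ (inj₂ (inj₂ h′x)))  = h′x

    placement-unique : ∀ {x r s} → Placement x r → Placement x s → r ≡ s
    placement-unique (at-hub₁ _)        (at-hub₁ _)          = refl
    placement-unique (at-hub₁ refl)     (at-hub₂ h≡h′)       = contradiction h≡h′ h≢h′
    placement-unique (at-hub₁ refl)     (at-leaf₁ hh _)      = contradiction hh adj-irrefl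
    placement-unique (at-hub₁ x≡h)      (at-leaf₂ _ x≢h _)   = contradiction x≡h x≢h
    placement-unique (at-hub₂ refl)     (at-hub₁ h′≡h)       = contradiction (sym h′≡h) h≢h′
    placement-unique (at-hub₂ _)        (at-hub₂ _)          = refl
    placement-unique (at-hub₂ x≡h′)     (at-leaf₁ _ x≢h′)    = contradiction x≡h′ x≢h′
    placement-unique (at-hub₂ refl)     (at-leaf₂ h′h′ _ _)  = contradiction h′h′ adj-irrefl
    placement-unique (at-leaf₁ hh _)    (at-hub₁ refl)       = contradiction hh adj-irrefl
    placement-unique (at-leaf₁ _ x≢h′)  (at-hub₂ x≡h′)       = contradiction x≡h′ x≢h′
    placement-unique (at-leaf₁ _ _)     (at-leaf₁ _ _)       = refl
    placement-unique (at-leaf₁ hx _)    (at-leaf₂ _ _ ¬hx)   = contradiction hx ¬hx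
    placement-unique (at-leaf₂ _ x≢h _) (at-hub₁ x≡h)        = contradiction x≡h x≢h
    placement-unique (at-leaf₂ h′h′ _ _) (at-hub₂ refl)      = contradiction h′h′ adj-irrefl
    placement-unique (at-leaf₂ _ _ ¬hx) (at-leaf₁ hx _)      = contradiction hx ¬hx
    placement-unique (at-leaf₂ _ _ _)   (at-leaf₂ _ _ _)     = refl

    placement-adj : ∀ {x y r s} → Placement x r → Placement y s → adj G x y ≡ roleAdj r s
    placement-adj (at-hub₁ refl) (at-hub₁ refl) = ¬T⇒≡false adj-irrefl
    placement-adj (at-hub₁ refl) (at-hub₂ refl) = T⇒≡true (target-adj h)
    placement-adj (at-hub₁ refl) (at-leaf₁ hy _) = T⇒≡true hy
    placement-adj (at-hub₁ refl) (at-leaf₂ _ _ ¬hy) = ¬T⇒≡false ¬hy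
    placement-adj (at-hub₂ refl) (at-hub₁ refl) = T⇒≡true (adj-sym (target-adj h))
    placement-adj (at-hub₂ refl) (at-hub₂ refl) = ¬T⇒≡false adj-irrefl
    placement-adj (at-hub₂ refl) (at-leaf₁ hy y≢h′) =
      ¬T⇒≡false (h≢h′ ∘ sym ∘ hangs-off hy y≢h′ ∘ adj-sym)
    placement-adj (at-hub₂ refl) (at-leaf₂ h′y _ _) = T⇒≡true h′y
    placement-adj (at-leaf₁ hx _) (at-hub₁ refl) = T⇒≡true (adj-sym hx)
    placement-adj (at-leaf₁ hx x≢h′) (at-hub₂ refl) = ¬T⇒≡false (h≢h′ ∘ sym ∘ hangs-off hx x≢h′)
    placement-adj (at-leaf₁ hx x≢h′) (at-leaf₁ hy _) =
      ¬T⇒≡false (adj⇒≢ hy ∘ sym ∘ hangs-off hx x≢h′)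
    placement-adj (at-leaf₁ hx x≢h′) (at-leaf₂ _ y≢h _) = ¬T⇒≡false (y≢h ∘ hangs-off hx x≢h′)
    placement-adj (at-leaf₂ _ _ ¬hx) (at-hub₁ refl) = ¬T⇒≡false (¬hx ∘ adj-sym)
    placement-adj (at-leaf₂ h′x _ _) (at-hub₂ refl) = T⇒≡true (adj-sym h′x)
    placement-adj (at-leaf₂ h′x x≢h _) (at-leaf₁ _ y≢h′) =
      ¬T⇒≡false (y≢h′ ∘ hangs-off-h′ h′x x≢h)
    placement-adj (at-leaf₂ h′x x≢h _) (at-leaf₂ h′y _ _) =
      ¬T⇒≡false (adj⇒≢ h′y ∘ sym ∘ hangs-off-h′ h′x x≢h)

    role : Fin n → Role
    role = proj₁ ∘ placement

    role-placed : ∀ {x r} → Placement x r → role x ≡ r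
    role-placed = placement-unique (proj₂ (placement _))

    placed-role : ∀ {x r} → role x ≡ r → Placement x r
    placed-role {x} refl = proj₂ (placement x)

    role-hub₁ : ∀ {x} → role x ≡ hub₁ → x ≡ h
    role-hub₁ x-role with at-hub₁ x≡h ← placed-role x-role = x≡h

    role-hub₂ : ∀ {x} → role x ≡ hub₂ → x ≡ h′
    role-hub₂ x-role with at-hub₂ x≡h′ ← placed-role x-role = x≡h′

    leaves₁ leaves₂ : ℕ
    leaves₁ = count (λ x → role x ≟ᴿ leaf₁)
    leaves₂ = count (λ x → role x ≟ᴿ leaf₂)

    fibre↔slot : ∀ r → Fibre role r ↔ Slot leaves₁ leaves₂ r
    fibre↔slot hub₁  = fibre↔⊤ role h  (role-placed (at-hub₁ refl)) role-hub₁
    fibre↔slot hub₂  = fibre↔⊤ role h′ (role-placed (at-hub₂ refl)) role-hub₂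
    fibre↔slot leaf₁ = Σ↔count (λ x → role x ≟ᴿ leaf₁) uip
    fibre↔slot leaf₂ = Σ↔count (λ x → role x ≟ᴿ leaf₂) uip

    some-leaf₁ : ∃ λ l → Placement l leaf₁
    some-leaf₁ = let (l , hl , l≢h′) = leaf-of-h in l , at-leaf₁ hl l≢h′

    some-leaf₂ : ∃ λ l → Placement l leaf₂
    some-leaf₂ = let (l , h′l , l≢h) = shunt-onward (shunts-target h) in
      l , at-leaf₂ h′l l≢h λ hl →
        h≢h′ (sym (hangs-off hl (adj⇒≢ h′l ∘ sym) (adj-sym h′l)))

    shuntMap⇒structure : Σ ℕ λ m₁ → Σ ℕ λ m₂ → 1 ≤ m₁ × 1 ≤ m₂ × BistarStructure G m₁ m₂
    shuntMap⇒structure =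
      leaves₁ , leaves₂ , inhabited (fibre↔slot leaf₁) some-leaf₁ ,
      inhabited (fibre↔slot leaf₂) some-leaf₂ , record
        { role       = role
        ; adj-role   = λ x y → placement-adj (proj₂ (placement x)) (proj₂ (placement y))
        ; fibre↔slot = fibre↔slot
        }
      where
      inhabited : ∀ {r m} → Fibre role r ↔ Fin m → ∃ (flip Placement r) → 1 ≤ m
      inhabited {m = m} e (l , l-placed) =
        >-nonZero⁻¹ m {{nonZeroIndex (Inverse.to e (l , role-placed l-placed))}}

mainTheorem15 : (n : ℕ) (G : Graph n) → 3 ≤ n → Connected G →
    ((Fin n ↔ A1Vertex G) ⇔
     Σ ℕ (λ m₁ → Σ ℕ (λ m₂ → (1 ≤ m₁) × (1 ≤ m₂) × IsBistar G m₁ m₂)))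
mainTheorem15 n G (s≤s _) connected = mk⇔
  (λ e → let (m₁ , m₂ , 1≤m₁ , 1≤m₂ , S) = shuntMap⇒structure connected (↔⇒shuntMap connected e) zero
         in m₁ , m₂ , 1≤m₁ , 1≤m₂ , structure⇒isBistar S)
  (λ (_ , _ , 1≤m₁ , 1≤m₂ , iso) →
     shuntMap⇒↔ (structure⇒shuntMap (isBistar⇒structure iso) (occupied 1≤m₁ 1≤m₂)))
  where open Shunting G
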